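{- A connected graph $G$ is distance critical if and only if every vertex $v \in V(G)$ admits a determining pair $\{a,b\}$ with $a,b \in V(G)$.
   Context: All graphs are finite, simple and undirected. For vertices $x,y$ of a graph $G$, $d_G(x,y)$ is the length of a shortest path from $x$ to $y$ in $G$ ($\infty$ if none exists). A graph $G$ is distance critical if for every vertex $v \in V(G)$ there exist vertices $x,y \in V(G)\setminus\{v\}$ with $d_G(x,y) \neq d_{G-v}(x,y)$. A pair of vertices $\{a,b\}$ is a determining pair for a vertex $v$ if $a$ and $b$ are distinct and nonadjacent and $v$ is their unique common neighbor. -}

module Defs where

open import Data.Nat using (ℕ; zero; suc; _<_)
open import Data.Fin using (Fin)
open import Data.Maybe using (Maybe; just; nothing)
open import Data.Product using (Σ; ∃; ∃-syntax; _×_; _,_)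
open import Data.Unit using (⊤)
open import Relation.Nullary using (¬_; Dec)
open import Relation.Binary.PropositionalEquality using (_≡_; _≢_)

record Graph (n : ℕ) : Set₁ where
  field
    Adj    : Fin n → Fin n → Set
    adj?   : ∀ x y → Dec (Adj x y)
    sym    : ∀ {x y} → Adj x y → Adj y x
    irrefl : ∀ {x} → ¬ Adj x x
open Graph public

-- Walks of length k from x to y all of whose vertices satisfy P.
-- P = (λ _ → ⊤) gives walks in G; P = (λ w → w ≢ v) gives walks in G - v.
data Walk {n : ℕ} (G : Graph n) (P : Fin n → Set) : Fin n → Fin n → ℕ → Set where
  here : ∀ {x} → P x → Walk G P x x zero
  step : ∀ {x y z k} → P x → Adj G x y → Walk G P y z k → Walk G P x z (suc k)

-- Distance in the graph induced on the vertices satisfying P,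
-- valued in Maybe ℕ (nothing = ∞).
data DistIs {n : ℕ} (G : Graph n) (P : Fin n → Set) (x y : Fin n) : Maybe ℕ → Set where
  finite   : ∀ {k} → Walk G P x y k → (∀ j → j < k → ¬ Walk G P x y j) → DistIs G P x y (just k)
  infinite : (∀ k → ¬ Walk G P x y k) → DistIs G P x y nothing

All : ∀ {n} → Fin n → Set
All _ = ⊤

Minus : ∀ {n} → Fin n → Fin n → Set
Minus v w = w ≢ v

Connected : ∀ {n} → Graph n → Set
Connected {n} G = ∀ (x y : Fin n) → ∃[ k ] Walk G All x y k

DistanceChanges : ∀ {n} → Graph n → Fin n → Fin n → Fin n → Set
DistanceChanges G v x y =
  Σ (Maybe _) λ d → Σ (Maybe _) λ d′ →
    DistIs G All x y d × DistIs G (Minus v) x y d′ × d ≢ d′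

DistanceCritical : ∀ {n} → Graph n → Set
DistanceCritical {n} G =
  ∀ (v : Fin n) → ∃[ x ] ∃[ y ] (x ≢ v × y ≢ v × DistanceChanges G v x y)

DeterminingPair : ∀ {n} → Graph n → Fin n → Fin n → Fin n → Set
DeterminingPair {n} G v a b =
  a ≢ b × ¬ Adj G a b × Adj G a v × Adj G b v ×
  (∀ (w : Fin n) → Adj G a w → Adj G b w → w ≡ v)

{-# OPTIONS --safe #-}
-- If deleting v changes d(x, y), a shortest x–y walk must pass through v, entering from some a
-- and leaving to some b, and it cannot return to v (that would give a shortcut).  Then a ≠ b
-- and a ≁ b, or the walk could be shortened, and a common neighbour u ≠ v of a and b would
-- give an equally short walk avoiding v; so {a, b} is a determining pair.  Conversely a
-- determining pair {a, b} of v has d_G(a, b) = 2, while in G − v no walk a – u – b exists.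
-- Constructively the only real work is that distances exist at all: walks of each length are
-- decidable, and by the pigeonhole principle a walk of length ≥ n revisits a vertex and can be
-- shortened, so a bounded search decides reachability.
module Submission where

open import Defs
open import Data.Nat using (ℕ; zero; suc; _+_; _∸_; _≤_; _<_; s≤s)
open import Data.Nat.Properties
  using (≤-refl; n≤1+n; m≤n⇒m≤1+n; m≤n+m; m∸n≤m; +-monoʳ-≤; +-suc; <-irrefl; <-cmp;
         <-≤-trans; ≮⇒≥; _<?_; m<1+n⇒m<n∨m≡n)
open import Data.Nat.Induction using (<-wellFounded)
open import Induction.WellFounded using (Acc; acc)
open import Data.Fin using (Fin; toℕ) renaming (zero to fzero; suc to fsuc)
open import Data.Fin.Properties using (any?; pigeonhole; _≟_)
open import Data.Maybe using (just; nothing)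
open import Data.Product using (∃; ∃-syntax; _×_; _,_)
open import Data.Sum using (_⊎_; inj₁; inj₂)
open import Data.Unit using (tt)
open import Data.Empty using (⊥-elim)
open import Relation.Nullary using (¬_; Dec; yes; no)
open import Relation.Nullary.Decidable using (_×-dec_; ¬?)
open import Relation.Binary.PropositionalEquality using (_≡_; _≢_; refl) renaming (sym to ≡-sym)
open import Relation.Binary.Definitions using (tri<; tri≈; tri>)
open import Function.Bundles using (_⇔_; mk⇔)

search-least : ∀ {p} {Q : ℕ → Set p} → (∀ k → Dec (Q k)) → ∀ N →
               (∃ λ k → Q k × (∀ j → j < k → ¬ Q j)) ⊎ (∀ k → k < N → ¬ Q k)
search-least Q? zero = inj₂ λ _ ()
search-least {Q = Q} Q? (suc N) with search-least Q? N
... | inj₁ least = inj₁ least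
... | inj₂ none<N with Q? N
...   | yes QN = inj₁ (N , QN , none<N)
...   | no ¬QN = inj₂ none<1+N
  where
  none<1+N : ∀ k → k < suc N → ¬ Q k
  none<1+N k k<1+N with m<1+n⇒m<n∨m≡n k<1+N
  ... | inj₁ k<N = none<N k k<N
  ... | inj₂ refl = ¬QN

module _ {n : ℕ} (G : Graph n) where

  adj⇒≢ : ∀ {x y} → Adj G x y → x ≢ y
  adj⇒≢ xy refl = irrefl G xy

  _++_ : ∀ {P x y z i j} → Walk G P x y i → Walk G P y z j → Walk G P x z (i + j)
  here _     ++ q = q
  step p e w ++ q = step p e (w ++ q)

  unrestrict : ∀ {P x y k} → Walk G P x y k → Walk G All x y k
  unrestrict (here _)     = here tt
  unrestrict (step _ e w) = step tt e (unrestrict w)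

  walk? : ∀ {P} → (∀ w → Dec (P w)) → ∀ x y k → Dec (Walk G P x y k)
  walk? P? x y zero with P? x | x ≟ y
  ... | yes Px | yes refl = yes (here Px)
  ... | no ¬Px | _        = no λ { (here Px) → ¬Px Px }
  ... | yes _  | no x≢y   = no λ { (here _) → x≢y refl }
  walk? P? x y (suc k) with any? (λ u → P? x ×-dec (adj? G x u ×-dec walk? P? u y k))
  ... | yes (_ , Px , xu , w) = yes (step Px xu w)
  ... | no ∄u                 = no λ { (step Px xu w) → ∄u (_ , Px , xu , w) }

  vertex : ∀ {P x y m} → Walk G P x y m → Fin (suc m) → Fin n
  vertex {x = x} _ fzero       = x
  vertex (step _ _ w) (fsuc i) = vertex w i

  drop : ∀ {P x y m} (w : Walk G P x y m) (i : Fin (suc m)) →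
         Walk G P (vertex w i) y (m ∸ toℕ i)
  drop w            fzero    = w
  drop (step _ _ w) (fsuc i) = drop w i

  shortcut : ∀ {P x y m} (w : Walk G P x y m) (i j : Fin (suc m)) → toℕ i < toℕ j →
             vertex w i ≡ vertex w j → ∃ λ m′ → m′ < m × Walk G P x y m′
  shortcut (step _ _ w) fzero (fsuc j) _ refl = _ , s≤s (m∸n≤m _ (toℕ j)) , drop w j
  shortcut (step Px e w) (fsuc i) (fsuc j) (s≤s i<j) wᵢ≡wⱼ with shortcut w i j i<j wᵢ≡wⱼ
  ... | m′ , m′<m , w′ = suc m′ , s≤s m′<m , step Px e w′

  shorten-long : ∀ {P x y m} → Walk G P x y m → n ≤ m → ∃ λ m′ → m′ < m × Walk G P x y m′
  shorten-long w n≤m with pigeonhole (s≤s n≤m) (vertex w)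
  ... | i , j , i<j , wᵢ≡wⱼ = shortcut w i j i<j wᵢ≡wⱼ

  shorten-below-n : ∀ {P x y m} → Acc _<_ m → Walk G P x y m →
                    ∃ λ m′ → m′ < n × Walk G P x y m′
  shorten-below-n {m = m} (acc rs) w with m <? n
  ... | yes m<n = m , m<n , w
  ... | no m≮n with shorten-long w (≮⇒≥ m≮n)
  ...   | m′ , m′<m , w′ = shorten-below-n (rs m′<m) w′

  distance : ∀ {P} → (∀ w → Dec (P w)) → ∀ x y → ∃ (DistIs G P x y)
  distance P? x y with search-least (walk? P? x y) n
  ... | inj₁ (k , w , minimal) = just k , finite w minimal
  ... | inj₂ none<n = nothing , infinite unreachable
    where
    unreachable : ∀ k → ¬ Walk G _ x y k
    unreachable k w with shorten-below-n (<-wellFounded k) w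
    ... | m , m<n , w′ = none<n m m<n w′

  distance-changed⇒restricted-walks-longer : ∀ {P x y k d′ m} →
    DistIs G All x y (just k) → DistIs G P x y d′ → just k ≢ d′ → Walk G P x y m → k < m
  distance-changed⇒restricted-walks-longer _ (infinite ∄w) _ w = ⊥-elim (∄w _ w)
  distance-changed⇒restricted-walks-longer {k = k} {m = m}
    (finite _ shortest) (finite {k′} w′ shortest′) k≢k′ w with <-cmp k′ k
  ... | tri< k′<k _ _ = ⊥-elim (shortest k′ k′<k (unrestrict w′))
  ... | tri≈ _ refl _ = ⊥-elim (k≢k′ refl)
  ... | tri> _ _ k<k′ with m <? k′
  ...   | yes m<k′ = ⊥-elim (shortest′ m m<k′ w)
  ...   | no m≮k′  = <-≤-trans k<k′ (≮⇒≥ m≮k′)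

  module _ (v : Fin n) where

    data FirstVisit (x y : Fin n) : ℕ → Set where
      avoids : ∀ {k} → Walk G (Minus v) x y k → FirstVisit x y k
      enters : ∀ {a i j} → Walk G (Minus v) x a i → Adj G a v → Walk G All v y j →
               FirstVisit x y (suc (i + j))

    first-visit : ∀ {x y k} → x ≢ v → Walk G All x y k → FirstVisit x y k
    first-visit x≢v (here _) = avoids (here x≢v)
    first-visit x≢v (step {y = u} _ xu w) with u ≟ v
    ... | yes refl = enters (here x≢v) xu w
    ... | no u≢v with first-visit u≢v w
    ...   | avoids w′     = avoids (step x≢v xu w′)
    ...   | enters p av q = enters (step x≢v xu p) av q

    shortest-walk-through⇒determining-pair : ∀ {x y k} → x ≢ v → y ≢ v →
      Walk G All x y k → (∀ j → j < k → ¬ Walk G All x y j) →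
      (∀ {m} → Walk G (Minus v) x y m → k < m) →
      ∃[ a ] ∃[ b ] DeterminingPair G v a b
    shortest-walk-through⇒determining-pair x≢v y≢v w shortest avoiding-longer
      with first-visit x≢v w
    ... | avoids w′ = ⊥-elim (<-irrefl refl (avoiding-longer w′))
    ... | enters _ _ (here _) = ⊥-elim (y≢v refl)
    ... | enters {a} {i} p av (step {y = b} {k = j} _ vb r)
      with first-visit (adj⇒≢ (sym G vb)) r
    ...   | enters _ _ q′ =
      ⊥-elim (shortest _ (s≤s (+-monoʳ-≤ i (m≤n⇒m≤1+n (s≤s (m≤n+m _ _)))))
                         (unrestrict p ++ step tt av q′))
    ...   | avoids r′ = a , b , a≢b , a≁b , av , sym G vb , unique
      where
      a≢b : a ≢ b
      a≢b refl = shortest _ (s≤s (+-monoʳ-≤ i (n≤1+n j))) (unrestrict (p ++ r′))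
      a≁b : ¬ Adj G a b
      a≁b ab = shortest _ (s≤s (+-monoʳ-≤ i ≤-refl)) (unrestrict p ++ step tt ab (unrestrict r′))
      unique : ∀ u → Adj G a u → Adj G b u → u ≡ v
      unique u au bu with u ≟ v
      ... | yes u≡v = u≡v
      ... | no u≢v  = ⊥-elim (<-irrefl (≡-sym (+-suc i (suc j)))
                        (avoiding-longer (p ++ step (adj⇒≢ av) au (step u≢v (sym G bu) r′))))

    distance-changes⇒determining-pair : Connected G → ∀ {x y} → x ≢ v → y ≢ v →
      DistanceChanges G v x y → ∃[ a ] ∃[ b ] DeterminingPair G v a b
    distance-changes⇒determining-pair connected {x} {y} _ _ (_ , _ , infinite ∄w , _)
      with connected x y
    ... | k , w = ⊥-elim (∄w k w)
    distance-changes⇒determining-pair _ x≢v y≢v (_ , _ , dist@(finite w shortest) , dist′ , d≢d′) =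
      shortest-walk-through⇒determining-pair x≢v y≢v w shortest
        (distance-changed⇒restricted-walks-longer dist dist′ d≢d′)

    determining-pair⇒distance-changes : ∀ {a b} → DeterminingPair G v a b → DistanceChanges G v a b
    determining-pair⇒distance-changes {a} {b} (a≢b , a≁b , av , bv , unique)
      with distance (λ w → ¬? (w ≟ v)) a b
    ... | d′ , dist′ =
      just 2 , d′ , finite (step tt av (step tt (sym G bv) (here tt))) no-shorter , dist′ ,
      λ { refl → not-two dist′ }
      where
      no-shorter : ∀ j → j < 2 → ¬ Walk G All a b j
      no-shorter 0 _ (here _)             = a≢b refl
      no-shorter 1 _ (step _ ab (here _)) = a≁b ab
      no-shorter (suc (suc _)) (s≤s (s≤s ())) _
      not-two : ¬ DistIs G (Minus v) a b (just 2)
      not-two (finite (step _ au (step u≢v ub (here _))) _) = u≢v (unique _ au (sym G ub))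

proposition2p4 : ∀ {n : ℕ} (G : Graph n) → Connected G →
    (DistanceCritical G ⇔ (∀ (v : Fin n) → ∃[ a ] ∃[ b ] DeterminingPair G v a b))
proposition2p4 G connected = mk⇔ critical⇒pairs pairs⇒critical
  where
  critical⇒pairs : DistanceCritical G → ∀ v → ∃[ a ] ∃[ b ] DeterminingPair G v a b
  critical⇒pairs critical v with critical v
  ... | _ , _ , x≢v , y≢v , changes =
    distance-changes⇒determining-pair G v connected x≢v y≢v changes

  pairs⇒critical : (∀ v → ∃[ a ] ∃[ b ] DeterminingPair G v a b) → DistanceCritical G
  pairs⇒critical pairs v with pairs v
  ... | a , b , pair@(_ , _ , av , bv , _) =
    a , b , adj⇒≢ G av , adj⇒≢ G bv , determining-pair⇒distance-changes G v pair
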